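{- Let $\Gamma$ be any spanning subgraph of $G$ (i.e., any outcome of $G_p$) and let $u\ge 2$. Then there are at most two minimal obstructions $U$ for $\Gamma$ with $|U|=u$ having the same set $W\cup S\cup B$.
   Context: Setting: $C>1$ is a fixed integer; for $i\in[t]$, $H_i$ is a connected $d_i$-regular graph with $1<|V(H_i)|\le C$; $G=\square_{i=1}^t H_i$ (vertex set $V(H_1)\times\cdots\times V(H_t)$, $u,v$ adjacent iff they differ in exactly one coordinate $i$ with $\{u_i,v_i\}\in E(H_i)$), $V=V(G)$, $n=|V|$, $d=\sum_i d_i$; $p\in(0,1)$. For a spanning subgraph $\Gamma$ of $G$: a set $U\subseteq V$ is an obstruction (for $\Gamma$) if $|U|\ge1$ and the number of connected components of $\Gamma[V\setminus U]$ whose number of vertices is different from two is at least $|U|+1$. A minimal obstruction is an obstruction of smallest possible size among all obstructions for $\Gamma$. Given $U$, let $V_1$ be the set of vertices forming components of size one in $\Gamma[V\setminus U]$, $W$ the union of components of size two, $S$ the union of components whose size lies in $[3,n/d^{C^3/p}]$, and $B$ the union of components of size larger than $n/d^{C^3/p}$ (these sets depend on $U$). -}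

module Defs where

open import Data.Nat using (ℕ; zero; suc; _≤_; _<_)
open import Data.Bool using (Bool; true; false)
open import Data.Fin using (Fin)
open import Data.List using (List; []; _∷_; length; allFin; filterᵇ)
open import Data.List.Membership.Propositional using (_∈_)
open import Data.List.Relation.Unary.Unique.Propositional using (Unique)
open import Data.List.Relation.Unary.All using (All)
open import Data.List.Relation.Unary.AllPairs using (AllPairs)
open import Data.Product using (Σ; ∃; _×_; _,_)
open import Data.Sum using (_⊎_)
open import Data.Empty using (⊥)
open import Data.Unit using (⊤)
open import Relation.Nullary using (¬_)
open import Relation.Binary.PropositionalEquality using (_≡_)
open import Function.Bundles using (_⇔_)

record FGraph : Set where
  field
    size : ℕ
    adj  : Fin size → Fin size → Bool
open FGraph public

data Reach {A : Set} (X : A → Set) (E : A → A → Set) : A → A → Set where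
  here : ∀ {a} → X a → Reach X E a a
  step : ∀ {a b c} → Reach X E a b → X c → E b c → Reach X E a c

HasSize : {A : Set} → (A → Set) → ℕ → Set
HasSize {A} P s = Σ (List A) λ xs → Unique xs × (∀ x → (x ∈ xs) ⇔ P x) × length xs ≡ s

degree : (H : FGraph) → Fin (size H) → ℕ
degree H x = length (filterᵇ (adj H x) (allFin (size H)))

record Factor (C : ℕ) (H : FGraph) : Set where
  field
    size-gt-1 : 1 < size H
    size-le-C : size H ≤ C
    symmetric : ∀ x y → adj H x y ≡ adj H y x
    irreflexive : ∀ x → adj H x x ≡ false
    connected : ∀ x y → Reach (λ _ → ⊤) (λ a b → adj H a b ≡ true) x y
    regular : ∃ λ d → ∀ x → degree H x ≡ d

-- Vertices of the Cartesian product of a list of graphs H₁ □ ⋯ □ H_t.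
data Vert : List FGraph → Set where
  []  : Vert []
  _∷_ : ∀ {H Hs} → Fin (size H) → Vert Hs → Vert (H ∷ Hs)

ProdAdj : ∀ {Hs} → Vert Hs → Vert Hs → Set
ProdAdj [] [] = ⊥
ProdAdj {H ∷ _} (x ∷ u) (y ∷ v) = (adj H x y ≡ true × u ≡ v) ⊎ (x ≡ y × ProdAdj u v)

module _ {V : Set} (Γ : V → V → Bool) where

  Edge : V → V → Set
  Edge a b = Γ a b ≡ true

  Outside : (V → Bool) → V → Set
  Outside U v = U v ≡ false

  Comp : (V → Bool) → V → V → Set
  Comp U v w = Reach (Outside U) Edge v w

  -- Γ[V \ U] has at least k distinct components whose size is different from two
  -- (witnessed by k representatives lying in pairwise distinct components).
  AtLeastCompsNot2 : (V → Bool) → ℕ → Set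
  AtLeastCompsNot2 U k = Σ (List V) λ reps →
    length reps ≡ k ×
    All (λ v → Outside U v × ¬ HasSize (Comp U v) 2) reps ×
    AllPairs (λ a b → ¬ Comp U a b) reps

  Obstruction : (V → Bool) → ℕ → Set
  Obstruction U s = HasSize (λ v → U v ≡ true) s × 1 ≤ s × AtLeastCompsNot2 U (suc s)

  MinObstruction : (V → Bool) → ℕ → Set
  MinObstruction U s = Obstruction U s × (∀ U' s' → Obstruction U' s' → s ≤ s')

  -- W ∪ S ∪ B : vertices of V \ U whose component in Γ[V \ U] has size ≠ 1
  WSB : (V → Bool) → V → Set
  WSB U v = Outside U v × ¬ HasSize (Comp U v) 1

{-# OPTIONS --safe #-}

-- Write WSB(U) for the vertices of Γ − U that are not isolated there. Let U be a minimal
-- obstruction of size u and U' a set of size u with WSB(U') = WSB(U). A walk in Γ − (U ∩ U')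
-- that starts outside U ∪ U' never enters U ∪ U': its first vertex in U ∖ U' (say) has a
-- neighbour outside both sets, so it is in WSB(U') but not in WSB(U). Hence every component of
-- Γ − U missing U' is also a component of Γ − (U ∩ U'). Distinct components of Γ − U of size
-- ≠ 2 that meet U' do so in distinct vertices of U' ∖ U, so at least |U ∩ U'| + 1 of the u + 1
-- such components survive; if U' ⊄ U and U ∩ U' ≠ ∅ this makes U ∩ U' a smaller obstruction.
-- So U' = U or U' ∩ U = ∅. Finally, three pairwise disjoint such sets cannot exist when u ≥ 2:
-- every vertex of the second one would be isolated in Γ, and deleting a single vertex of the
-- first one would leave two singleton components, an obstruction of size 1.

module Submission where

open import Defs
open import Level using (0ℓ)
open import Data.Nat using (ℕ; suc; _+_; _≤_; _<_; z≤n; s≤s)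
open import Data.Nat.Properties
  using (≤-refl; ≤-reflexive; <⇒≱; m<m+n; +-comm; +-suc; +-monoʳ-≤; +-cancelʳ-≤; m≤n⇒m⊓n≡m; module ≤-Reasoning)
open import Data.Bool using (Bool; true; false; _∧_)
import Data.Bool as Bool
open import Data.Bool.Properties using (not-¬; ¬-not; ∧-conicalˡ; ∧-conicalʳ; ∧-zeroʳ)
import Data.Fin as Fin
open import Data.List using (List; []; _∷_; length; filter; take)
open import Data.List.Properties using (filter-notAll; length-take)
open import Data.List.Membership.Propositional using (_∈_; find)
open import Data.List.Membership.Propositional.Properties using (∈-filter⁺; ∈-filter⁻)
open import Data.List.Relation.Unary.Any as Any using (here; there)
open import Data.List.Relation.Unary.All as All using (All; []; _∷_)
import Data.List.Relation.Unary.All.Properties as Allₚ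
open import Data.List.Relation.Unary.AllPairs using (AllPairs; []; _∷_)
import Data.List.Relation.Unary.AllPairs.Properties as AllPairsₚ
open import Data.List.Relation.Unary.Unique.Propositional using (Unique)
import Data.List.Relation.Unary.Unique.Propositional.Properties as Uniqueₚ
open import Data.Product using (Σ; ∃₂; _×_; _,_; proj₁; proj₂)
open import Data.Sum using (_⊎_; inj₁; inj₂)
open import Data.Empty using (⊥; ⊥-elim)
open import Function using (_∘_)
open import Function.Bundles using (_⇔_; mk⇔; Equivalence)
import Function.Properties.Equivalence as ⇔
open import Relation.Nullary using (¬_; yes; no; does; ¬?; contradiction)
open import Relation.Nullary.Decidable using (dec-true; dec-false)
open import Relation.Unary using (Pred; _⊆_; _∩_; ∁; Decidable; _≐_)
open import Relation.Unary.Properties using (∁?)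
open import Relation.Binary.Definitions using (DecidableEquality)
open import Relation.Binary.PropositionalEquality
  using (_≡_; _≢_; _≗_; refl; sym; trans; cong; cong₂; subst; ≢-sym)

open Equivalence using (to; from)

module _ {A : Set} where

  length-filter+length-filter-∁ : {P : Pred A 0ℓ} (P? : Decidable P) (xs : List A) →
    length (filter P? xs) + length (filter (∁? P?) xs) ≡ length xs
  length-filter+length-filter-∁ P? [] = refl
  length-filter+length-filter-∁ P? (x ∷ xs) with P? x
  ... | yes _ = cong suc (length-filter+length-filter-∁ P? xs)
  ... | no _  = trans (+-suc _ _) (cong suc (length-filter+length-filter-∁ P? xs))

  Unique-⊆⇒length-≤ : DecidableEquality A → {xs ys : List A} →
    Unique xs → (_∈ xs) ⊆ (_∈ ys) → length xs ≤ length ys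
  Unique-⊆⇒length-≤ _≟_ {[]} _ _ = z≤n
  Unique-⊆⇒length-≤ _≟_ {x ∷ xs} {ys} (x∉xs ∷ xs!) xs⊆ys = begin-strict
    length xs                         ≤⟨ Unique-⊆⇒length-≤ _≟_ xs! xs⊆ys-x ⟩
    length (filter (¬? ∘ (_≟ x)) ys)  <⟨ filter-notAll _ ys (Any.map (λ x≡y y≢x → y≢x (sym x≡y)) (xs⊆ys (here refl))) ⟩
    length ys                         ∎
    where
    open ≤-Reasoning
    xs⊆ys-x : (_∈ xs) ⊆ (_∈ filter (¬? ∘ (_≟ x)) ys)
    xs⊆ys-x z∈xs = ∈-filter⁺ (¬? ∘ (_≟ x)) (xs⊆ys (there z∈xs)) (≢-sym (All.lookup x∉xs z∈xs))

  AllPairs-mapWithAll : {P : Pred A 0ℓ} {R S : A → A → Set} → (∀ {a b} → P a → P b → R a b → S a b) →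
    {xs : List A} → All P xs → AllPairs R xs → AllPairs S xs
  AllPairs-mapWithAll f [] [] = []
  AllPairs-mapWithAll f (pa ∷ ps) (ra ∷ rs) =
    All.zipWith (λ (pb , r) → f pa pb r) (ps , ra) ∷ AllPairs-mapWithAll f ps rs

  HasSize-resp : {P Q : Pred A 0ℓ} {n : ℕ} → P ≐ Q → HasSize P n → HasSize Q n
  HasSize-resp (P⊆Q , Q⊆P) (xs , xs! , mem , len) =
    xs , xs! , (λ x → mk⇔ (P⊆Q ∘ to (mem x)) (from (mem x) ∘ Q⊆P)) , len

  HasSize⇒0< : {P : Pred A 0ℓ} {n : ℕ} {x : A} → HasSize P n → P x → 0 < n
  HasSize⇒0< (_ ∷ _ , _ , _ , refl) _ = s≤s z≤n
  HasSize⇒0< ([] , _ , mem , _) px with () ← from (mem _) px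

  HasSize-1⇒≡ : {P : Pred A 0ℓ} {x y : A} → HasSize P 1 → P x → P y → x ≡ y
  HasSize-1⇒≡ (_ ∷ [] , _ , mem , _) px py with from (mem _) px | from (mem _) py
  ... | here refl | here refl = refl

  HasSize-2≤⇒pair : {P : Pred A 0ℓ} {n : ℕ} → HasSize P n → 2 ≤ n → ∃₂ λ a b → a ≢ b × P a × P b
  HasSize-2≤⇒pair ([] , _ , _ , refl) ()
  HasSize-2≤⇒pair (_ ∷ [] , _ , _ , refl) (s≤s ())
  HasSize-2≤⇒pair (a ∷ b ∷ _ , (a≢b ∷ _) ∷ _ , mem , _) _ =
    a , b , a≢b , to (mem a) (here refl) , to (mem b) (there (here refl))

  HasSize-split : {P Q : Pred A 0ℓ} {n : ℕ} → HasSize P n → Decidable Q →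
    ∃₂ λ s t → HasSize (P ∩ Q) s × HasSize (P ∩ ∁ Q) t × s + t ≡ n
  HasSize-split {P} (xs , xs! , mem , refl) Q? =
    _ , _ , part Q? , part (∁? Q?) , length-filter+length-filter-∁ Q? xs
    where
    part : {R : Pred A 0ℓ} (R? : Decidable R) → HasSize (P ∩ R) (length (filter R? xs))
    part R? = filter R? xs , Uniqueₚ.filter⁺ R? xs! , (λ x → mk⇔
      (λ x∈ → let (x∈xs , rx) = ∈-filter⁻ R? x∈ in to (mem x) x∈xs , rx)
      (λ (px , rx) → ∈-filter⁺ R? (from (mem x) px) rx)) , refl

  HasSize-⊆-or-witness : {P Q : Pred A 0ℓ} {n : ℕ} → HasSize P n → Decidable Q →
    P ⊆ Q ⊎ Σ A λ x → P x × ¬ Q x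
  HasSize-⊆-or-witness (xs , _ , mem , _) Q? with All.all? Q? xs
  ... | yes all = inj₁ (λ px → All.lookup all (from (mem _) px))
  ... | no ¬all = let (x , x∈xs , ¬qx) = find (Allₚ.¬All⇒Any¬ Q? xs ¬all) in inj₂ (x , to (mem x) x∈xs , ¬qx)

  HasSize-⊆-sameSize⇒⊇ : DecidableEquality A → {P Q : Pred A 0ℓ} {n : ℕ} →
    HasSize P n → HasSize Q n → Decidable P → P ⊆ Q → Q ⊆ P
  HasSize-⊆-sameSize⇒⊇ _≟_ (xs , xs! , memP , refl) (ys , _ , memQ , lenQ) P? P⊆Q {v} qv with P? v
  ... | yes pv = pv
  ... | no ¬pv = contradiction (Unique-⊆⇒length-≤ _≟_ (v∉xs ∷ xs!) v∷xs⊆ys) (<⇒≱ (s≤s (≤-reflexive lenQ)))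
    where
    v∉xs : All (v ≢_) xs
    v∉xs = All.tabulate λ x∈xs v≡x → ¬pv (subst _ (sym v≡x) (to (memP _) x∈xs))
    v∷xs⊆ys : (_∈ v ∷ xs) ⊆ (_∈ ys)
    v∷xs⊆ys (here refl) = from (memQ v) qv
    v∷xs⊆ys (there x∈xs) = from (memQ _) (P⊆Q (to (memP _) x∈xs))

Reach-mono : {A : Set} {X Y : Pred A 0ℓ} {E : A → A → Set} {a b : A} → X ⊆ Y → Reach X E a b → Reach Y E a b
Reach-mono X⊆Y (here xa) = here (X⊆Y xa)
Reach-mono X⊆Y (step path xc e) = step (Reach-mono X⊆Y path) (X⊆Y xc) e

module _ {V : Set} where

  ⟦_⟧ : (V → Bool) → Pred V 0ℓ
  ⟦ U ⟧ v = U v ≡ true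

  ⟦_⟧? : (U : V → Bool) → Decidable ⟦ U ⟧
  ⟦ U ⟧? v = U v Bool.≟ true

  _∩ᵇ_ : (V → Bool) → (V → Bool) → V → Bool
  (U ∩ᵇ U') v = U v ∧ U' v

  ⟦⟧-∩ᵇ : ∀ {U U'} → ⟦ U ⟧ ∩ ⟦ U' ⟧ ≐ ⟦ U ∩ᵇ U' ⟧
  ⟦⟧-∩ᵇ = (λ (u , u′) → cong₂ _∧_ u u′) , λ u∧u′ → ∧-conicalˡ _ _ u∧u′ , ∧-conicalʳ _ _ u∧u′

  Disjoint : (V → Bool) → (V → Bool) → Set
  Disjoint U U' = ∀ v → U v ≡ true → U' v ≡ false

  Disjoint-sym : ∀ {U U'} → Disjoint U U' → Disjoint U' U
  Disjoint-sym U⊥U' v v∈U' = ¬-not λ v∈U → not-¬ (U⊥U' v v∈U) v∈U'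

module DecidableSubsets {V : Set} (_≟_ : DecidableEquality V) where

  singleton : V → V → Bool
  singleton x v = does (v ≟ x)

  HasSize-singleton : ∀ {x} → HasSize ⟦ singleton x ⟧ 1
  HasSize-singleton {x} =
    x ∷ [] , [] ∷ [] , (λ v → mk⇔ (λ { (here refl) → dec-true (x ≟ x) refl }) (member v)) , refl
    where
    member : ∀ v → does (v ≟ x) ≡ true → v ∈ x ∷ []
    member v _ with v ≟ x
    member v _  | yes refl = here refl
    member v () | no _

  sameSize-⊆⇒≗ : ∀ {U U' n} → HasSize ⟦ U ⟧ n → HasSize ⟦ U' ⟧ n → ⟦ U ⟧ ⊆ ⟦ U' ⟧ → U ≗ U'
  sameSize-⊆⇒≗ {U} {U'} hs hs' U⊆U' v with U v in v∈?U | U' v in v∈?U'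
  ... | true  | _     = trans (sym (U⊆U' v∈?U)) v∈?U'
  ... | false | false = refl
  ... | false | true  with () ← trans (sym v∈?U) (HasSize-⊆-sameSize⇒⊇ _≟_ hs hs' ⟦ U ⟧? U⊆U' v∈?U')

module Obstructions {V : Set} (_≟_ : DecidableEquality V) (Γ : V → V → Bool)
  (Γ-sym : ∀ a b → Γ a b ≡ Γ b a) (Γ-irrefl : ∀ a → ¬ Edge Γ a a) where

  open DecidableSubsets _≟_

  SameWSB : (V → Bool) → (V → Bool) → Set
  SameWSB U U' = ∀ v → WSB Γ U v ⇔ WSB Γ U' v

  RepNot2 : (V → Bool) → V → Set
  RepNot2 U v = Outside Γ U v × ¬ HasSize (Comp Γ U v) 2

  Apart : (V → Bool) → V → V → Set
  Apart U a b = ¬ Comp Γ U a b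

  Edge-sym : ∀ {a b} → Edge Γ a b → Edge Γ b a
  Edge-sym {a} {b} e = trans (Γ-sym b a) e

  adjacent⇒WSB : ∀ {U b c} → Outside Γ U b → Outside Γ U c → Edge Γ b c → WSB Γ U b
  adjacent⇒WSB b∉U c∉U e = b∉U , λ one →
    Γ-irrefl _ (subst (Edge Γ _) (sym (HasSize-1⇒≡ one (here b∉U) (step (here b∉U) c∉U e))) e)

  reps-Unique : ∀ {U R} → All (RepNot2 U) R → AllPairs (Apart U) R → Unique R
  reps-Unique = AllPairs-mapWithAll λ (a∉U , _) _ apart a≡b → apart (subst (Comp Γ _ _) a≡b (here a∉U))

  AtLeastCompsNot2-fromList : ∀ {U k} R → All (RepNot2 U) R → AllPairs (Apart U) R → k ≤ length R →
    AtLeastCompsNot2 Γ U k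
  AtLeastCompsNot2-fromList {k = k} R reps aparts k≤|R| =
    take k R , trans (length-take k R) (m≤n⇒m⊓n≡m k≤|R|) , Allₚ.take⁺ k reps , AllPairsₚ.take⁺ k aparts

  module _ {U U' : V → Bool} (same : SameWSB U' U) where

    Comp-∩ᵇ⇒Comp : ∀ {r w} → Outside Γ U' r → Outside Γ U r → Comp Γ (U' ∩ᵇ U) r w →
      Outside Γ U' w × Outside Γ U w × Comp Γ U r w
    Comp-∩ᵇ⇒Comp r∉U' r∉U (here _) = r∉U' , r∉U , here r∉U
    Comp-∩ᵇ⇒Comp r∉U' r∉U (step {c = c} path c∉U'∩U e) with Comp-∩ᵇ⇒Comp r∉U' r∉U path | U' c in c∈?U'
    ... | b∉U' , b∉U , path′ | true =
      contradiction c∈?U' (not-¬ (proj₁ (from (same c) (adjacent⇒WSB c∉U'∩U b∉U (Edge-sym e)))))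
    ... | b∉U' , b∉U , path′ | false =
      refl , c∉U , step path′ c∉U e
      where
      c∉U : Outside Γ U c
      c∉U = proj₁ (to (same c) (adjacent⇒WSB c∈?U' b∉U' (Edge-sym e)))

    Comp-∩ᵇ≐Comp : ∀ {r} → Outside Γ U' r → Outside Γ U r → Comp Γ (U' ∩ᵇ U) r ≐ Comp Γ U r
    Comp-∩ᵇ≐Comp r∉U' r∉U =
      proj₂ ∘ proj₂ ∘ Comp-∩ᵇ⇒Comp r∉U' r∉U , Reach-mono λ {v} v∉U → trans (cong (U' v ∧_) v∉U) (∧-zeroʳ (U' v))

    RepNot2-∩ᵇ : ∀ {r} → Outside Γ U' r → RepNot2 U r → RepNot2 (U' ∩ᵇ U) r
    RepNot2-∩ᵇ {r} r∉U' (r∉U , not2) =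
      cong (_∧ U r) r∉U' , not2 ∘ HasSize-resp (Comp-∩ᵇ≐Comp r∉U' r∉U)

    Apart-∩ᵇ : ∀ {a b} → Outside Γ U' a → RepNot2 U a → Apart U a b → Apart (U' ∩ᵇ U) a b
    Apart-∩ᵇ a∉U' (a∉U , _) apart = apart ∘ proj₁ (Comp-∩ᵇ≐Comp a∉U' a∉U)

    AtLeastCompsNot2-∩ᵇ : ∀ {s t} → AtLeastCompsNot2 Γ U (suc (s + t)) → HasSize (⟦ U' ⟧ ∩ ∁ ⟦ U ⟧) t →
      AtLeastCompsNot2 Γ (U' ∩ᵇ U) (suc s)
    AtLeastCompsNot2-∩ᵇ {s} {t} (R , |R| , reps , aparts) (ys , _ , mem , refl) =
      AtLeastCompsNot2-fromList R∖U'
        (All.map (λ (r∉U' , rep) → RepNot2-∩ᵇ r∉U' rep) reps∖U')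
        (AllPairs-mapWithAll (λ (a∉U' , rep) _ → Apart-∩ᵇ a∉U' rep) reps∖U' (AllPairsₚ.filter⁺ _ aparts))
        (+-cancelʳ-≤ t (suc s) (length R∖U') count)
      where
      open ≤-Reasoning
      R∩U' R∖U' : List V
      R∩U' = filter ⟦ U' ⟧? R
      R∖U' = filter (∁? ⟦ U' ⟧?) R
      reps∖U' : All (λ r → Outside Γ U' r × RepNot2 U r) R∖U'
      reps∖U' = All.zip (All.map ¬-not (Allₚ.all-filter (∁? ⟦ U' ⟧?) R) , Allₚ.filter⁺ _ reps)
      R∩U'⊆ys : (_∈ R∩U') ⊆ (_∈ ys)
      R∩U'⊆ys r∈ = let (r∈R , r∈U') = ∈-filter⁻ ⟦ U' ⟧? r∈ in
        from (mem _) (r∈U' , not-¬ (proj₁ (All.lookup reps r∈R)))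
      |R∩U'|≤t : length R∩U' ≤ t
      |R∩U'|≤t = Unique-⊆⇒length-≤ _≟_ (Uniqueₚ.filter⁺ ⟦ U' ⟧? (reps-Unique reps aparts)) R∩U'⊆ys
      count : suc s + t ≤ length R∖U' + t
      count = begin
        suc (s + t)                 ≡⟨ sym |R| ⟩
        length R                    ≡⟨ sym (length-filter+length-filter-∁ ⟦ U' ⟧? R) ⟩
        length R∩U' + length R∖U'   ≡⟨ +-comm (length R∩U') (length R∖U') ⟩
        length R∖U' + length R∩U'   ≤⟨ +-monoʳ-≤ (length R∖U') |R∩U'|≤t ⟩
        length R∖U' + t             ∎

  ∩ᵇ-smallerObstruction : ∀ {U U' u x v} → SameWSB U' U → Obstruction Γ U u → HasSize ⟦ U' ⟧ u →
    U' x ≡ true → ¬ U x ≡ true → U' v ≡ true → U v ≡ true →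
    Σ ℕ λ s → s < u × Obstruction Γ (U' ∩ᵇ U) s
  ∩ᵇ-smallerObstruction {U} same (_ , _ , comps) hs' x∈U' x∉U v∈U' v∈U with HasSize-split hs' ⟦ U ⟧?
  ... | s , t , hs∩ , hs∖ , refl =
    s , m<m+n s (HasSize⇒0< hs∖ (x∈U' , x∉U)) ,
    HasSize-resp ⟦⟧-∩ᵇ hs∩ , HasSize⇒0< hs∩ (v∈U' , v∈U) , AtLeastCompsNot2-∩ᵇ same comps hs∖

  ≗-or-Disjoint : ∀ {U U' u} → SameWSB U' U → HasSize ⟦ U' ⟧ u → MinObstruction Γ U u → U' ≗ U ⊎ Disjoint U' U
  ≗-or-Disjoint {U} same hs' (obs , minimal) with HasSize-⊆-or-witness hs' ⟦ U ⟧?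
  ... | inj₁ U'⊆U = inj₁ (sameSize-⊆⇒≗ hs' (proj₁ obs) U'⊆U)
  ... | inj₂ (x , x∈U' , x∉U) = inj₂ λ v v∈U' → ¬-not λ v∈U →
    let (_ , s<u , smaller) = ∩ᵇ-smallerObstruction same obs hs' x∈U' x∉U v∈U' v∈U
    in <⇒≱ s<u (minimal _ _ smaller)

  Isolated : V → Set
  Isolated y = ∀ w → ¬ Edge Γ y w

  Isolated-Comp : ∀ {U y w} → Isolated y → Comp Γ U y w → w ≡ y
  Isolated-Comp iso (here _) = refl
  Isolated-Comp iso (step path _ e) with refl ← Isolated-Comp iso path = ⊥-elim (iso _ e)

  Isolated⇒RepNot2 : ∀ {U y} → Isolated y → Outside Γ U y → RepNot2 U y
  Isolated⇒RepNot2 iso y∉U = y∉U , λ two →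
    let (a , b , a≢b , ya , yb) = HasSize-2≤⇒pair two ≤-refl
    in a≢b (trans (Isolated-Comp iso ya) (sym (Isolated-Comp iso yb)))

  two-isolated⇒singleton-obstruction : ∀ {x y₁ y₂} → Isolated y₁ → Isolated y₂ → y₁ ≢ y₂ → x ≢ y₁ → x ≢ y₂ →
    Obstruction Γ (singleton x) 1
  two-isolated⇒singleton-obstruction {x} {y₁} {y₂} iso₁ iso₂ y₁≢y₂ x≢y₁ x≢y₂ =
    HasSize-singleton , ≤-refl , y₁ ∷ y₂ ∷ [] , refl ,
    Isolated⇒RepNot2 iso₁ (dec-false (y₁ ≟ x) (≢-sym x≢y₁)) ∷
    Isolated⇒RepNot2 iso₂ (dec-false (y₂ ≟ x) (≢-sym x≢y₂)) ∷ [] ,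
    ((λ c → y₁≢y₂ (sym (Isolated-Comp iso₁ c))) ∷ []) ∷ [] ∷ []

  -- A neighbour w of y lies outside U₁ or outside U₃; then y is in WSB of that set, which is
  -- WSB(U₂), so y ∉ U₂.
  disjoint-sameWSB⇒Isolated : ∀ {U₁ U₂ U₃ y} → Disjoint U₂ U₁ → Disjoint U₂ U₃ → Disjoint U₁ U₃ →
    SameWSB U₁ U₂ → SameWSB U₃ U₂ → U₂ y ≡ true → Isolated y
  disjoint-sameWSB⇒Isolated {U₁} {y = y} d₂₁ d₂₃ d₁₃ same₁₂ same₃₂ y∈U₂ w e with U₁ w in w∈?U₁
  ... | false = not-¬ (proj₁ (to (same₁₂ y) (adjacent⇒WSB (d₂₁ y y∈U₂) w∈?U₁ e))) y∈U₂
  ... | true  = not-¬ (proj₁ (to (same₃₂ y) (adjacent⇒WSB (d₂₃ y y∈U₂) (d₁₃ w w∈?U₁) e))) y∈U₂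

  pairwise-Disjoint⇒¬MinObstruction : ∀ {u U₁ U₂ U₃} → 2 ≤ u → MinObstruction Γ U₁ u → HasSize ⟦ U₂ ⟧ u →
    Disjoint U₁ U₂ → Disjoint U₁ U₃ → Disjoint U₂ U₃ → SameWSB U₁ U₂ → SameWSB U₁ U₃ → ⊥
  pairwise-Disjoint⇒¬MinObstruction {U₂ = U₂} 2≤u ((size₁ , _) , minimal₁) size₂ d₁₂ d₁₃ d₂₃ same₁₂ same₁₃
    with HasSize-2≤⇒pair size₁ 2≤u | HasSize-2≤⇒pair size₂ 2≤u
  ... | x , _ , _ , x∈U₁ , _ | y₁ , y₂ , y₁≢y₂ , y₁∈U₂ , y₂∈U₂ =
    <⇒≱ 2≤u (minimal₁ _ _ (two-isolated⇒singleton-obstruction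
      (isolated y₁ y₁∈U₂) (isolated y₂ y₂∈U₂) y₁≢y₂ (x≢ y₁ y₁∈U₂) (x≢ y₂ y₂∈U₂)))
    where
    isolated : ∀ y → U₂ y ≡ true → Isolated y
    isolated _ = disjoint-sameWSB⇒Isolated (Disjoint-sym d₁₂) d₂₃ d₁₃ same₁₂
      λ v → ⇔.trans (⇔.sym (same₁₃ v)) (same₁₂ v)
    x≢ : ∀ y → U₂ y ≡ true → x ≢ y
    x≢ y y∈U₂ refl = not-¬ (d₁₂ x x∈U₁) y∈U₂

  minObstructions-sameWSB : ∀ {u} → 2 ≤ u → (U₁ U₂ U₃ : V → Bool) →
    MinObstruction Γ U₁ u → MinObstruction Γ U₂ u → MinObstruction Γ U₃ u →
    SameWSB U₁ U₂ → SameWSB U₁ U₃ → U₁ ≗ U₂ ⊎ U₁ ≗ U₃ ⊎ U₂ ≗ U₃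
  minObstructions-sameWSB 2≤u U₁ U₂ U₃ min₁ min₂ min₃ same₁₂ same₁₃
    with ≗-or-Disjoint same₁₂ (proj₁ (proj₁ min₁)) min₂
       | ≗-or-Disjoint same₁₃ (proj₁ (proj₁ min₁)) min₃
       | ≗-or-Disjoint (λ v → ⇔.trans (⇔.sym (same₁₂ v)) (same₁₃ v)) (proj₁ (proj₁ min₂)) min₃
  ... | inj₁ U₁≗U₂ | _          | _          = inj₁ U₁≗U₂
  ... | inj₂ _     | inj₁ U₁≗U₃ | _          = inj₂ (inj₁ U₁≗U₃)
  ... | inj₂ _     | inj₂ _     | inj₁ U₂≗U₃ = inj₂ (inj₂ U₂≗U₃)
  ... | inj₂ d₁₂   | inj₂ d₁₃   | inj₂ d₂₃   =
    ⊥-elim (pairwise-Disjoint⇒¬MinObstruction 2≤u min₁ (proj₁ (proj₁ min₂)) d₁₂ d₁₃ d₂₃ same₁₂ same₁₃)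

Vert-≟ : ∀ {Hs} → DecidableEquality (Vert Hs)
Vert-≟ [] [] = yes refl
Vert-≟ (x ∷ u) (y ∷ v) with x Fin.≟ y | Vert-≟ u v
... | yes refl | yes refl = yes refl
... | no x≢y   | _        = no λ { refl → x≢y refl }
... | yes _    | no u≢v   = no λ { refl → u≢v refl }

ProdAdj-irrefl : ∀ {C Hs} → All (Factor C) Hs → (a : Vert Hs) → ¬ ProdAdj a a
ProdAdj-irrefl (H ∷ _) (x ∷ _) (inj₁ (x~x , _)) = not-¬ (Factor.irreflexive H x) x~x
ProdAdj-irrefl (_ ∷ Hs) (_ ∷ u) (inj₂ (_ , u~u)) = ProdAdj-irrefl Hs u u~u

lemma3p3 : (C : ℕ) → 1 < C → (Hs : List FGraph) → All (Factor C) Hs →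
    (Γ : Vert Hs → Vert Hs → Bool) →
    (∀ a b → Γ a b ≡ Γ b a) →
    (∀ a b → Γ a b ≡ true → ProdAdj a b) →
    (u : ℕ) → 2 ≤ u →
    (U₁ U₂ U₃ : Vert Hs → Bool) →
    MinObstruction Γ U₁ u → MinObstruction Γ U₂ u → MinObstruction Γ U₃ u →
    (∀ v → WSB Γ U₁ v ⇔ WSB Γ U₂ v) →
    (∀ v → WSB Γ U₁ v ⇔ WSB Γ U₃ v) →
    (∀ v → U₁ v ≡ U₂ v) ⊎ (∀ v → U₁ v ≡ U₃ v) ⊎ (∀ v → U₂ v ≡ U₃ v)
lemma3p3 _ _ _ factors Γ Γ-sym Γ⊆G _ 2≤u =
  Obstructions.minObstructions-sameWSB Vert-≟ Γ Γ-sym (λ a a~a → ProdAdj-irrefl factors a (Γ⊆G a a a~a)) 2≤u
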